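{- Let $\vec T$ be a tournament on $2m$ vertices, where $m$ is divisible by $4$, and let $S_0,S_1$ be a partition of its vertex set into two sets of equal size $m$. Then there exists a vertex $v$ such that $d^+(v,S_0)\geq m/4$ and $d^+(v,S_1)\geq m/4$.
   Context: A tournament is an orientation of a complete graph. For a vertex $v$ and a vertex set $X$, $d^+(v,X)=|N^+(v)\cap X|$, where $N^+(v)$ is the set of out-neighbours of $v$. -}

module Defs where

open import Data.Nat using (ℕ)
open import Data.Bool using (Bool; true; false; _∧_)
open import Data.Fin using (Fin)
open import Data.List using (List; length; filter)
open import Data.List.Base using (allFin)
open import Relation.Binary.PropositionalEquality using (_≡_; _≢_)
open import Relation.Nullary using (¬_)
open import Data.Bool.Properties using (T?)
open import Data.Sum using (_⊎_)
open import Data.Product using (_×_)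
open import Data.Bool using (T)

record Tournament (n : ℕ) : Set where
  field
    arc      : Fin n → Fin n → Bool
    loopless : ∀ v → arc v v ≡ false
    total    : ∀ u v → u ≢ v → arc u v ≡ true ⊎ arc v u ≡ true
    antisym  : ∀ u v → ¬ (arc u v ≡ true × arc v u ≡ true)
open Tournament public

VSet : ℕ → Set
VSet n = Fin n → Bool

size : ∀ {n} → VSet n → ℕ
size {n} X = length (filter (λ w → T? (X w)) (allFin n))

outdeg : ∀ {n} → Tournament n → Fin n → VSet n → ℕ
outdeg {n} T v X = length (filter (λ w → T? (arc T v w ∧ X w)) (allFin n))

-- Write k = m/4 and suppose no vertex has k out-neighbours in both halves. In each half
-- Sᵢ the vertices with fewer than k out-neighbours inside Sᵢ span a subtournament of
-- maximum outdegree below k, hence have at most 2k - 1 members; so the rest Aᵢ of Sᵢ has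
-- at least 2k + 1 vertices, each with fewer than k out-neighbours in the other half.
-- Counting the |A₀||A₁| arcs between A₀ and A₁ by their tails then gives
-- |A₀||A₁| < (|A₀| + |A₁|) k, which is impossible once both |Aᵢ| ≥ 2k - 1.
module Submission where

open import Defs
open import Data.Nat using (ℕ; _*_; _≤_; _/_)
open import Data.Nat.Divisibility using (_∣_)
open import Data.Bool using (Bool; not)
open import Data.Fin using (Fin)
open import Data.Product using (Σ; _×_)
open import Relation.Binary.PropositionalEquality using (_≡_)

open import Data.Nat using (zero; suc; _+_; _<_; z≤n; s≤s; _≤?_; _<?_)
open import Data.Nat.Properties
open import Data.Nat.DivMod using (m*n/n≡m)
open import Data.Nat.Divisibility using (divides)
open import Data.Nat.Tactic.RingSolver using (solve-∀)
open import Data.Bool using (true; false; _∧_; T)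
open import Data.Bool.Properties using (T?; ∧-zeroʳ)
open import Data.Empty using (⊥-elim)
open import Data.Sum using (inj₁; inj₂)
open import Data.Product using (_,_)
open import Data.List using (List; []; _∷_; length; filter)
open import Data.List.Base using (allFin)
open import Data.List.Relation.Unary.All as All using (All; []; _∷_)
open import Data.List.Relation.Unary.All.Properties using (all-filter; filter⁺)
open import Data.List.Relation.Unary.AllPairs using (_∷_)
open import Data.List.Relation.Unary.Unique.Propositional using (Unique)
import Data.List.Relation.Unary.Unique.Propositional.Properties as Unique
open import Data.Fin.Properties using (any?)
open import Function using (_∘_)
open import Relation.Nullary using (¬_; yes; no; contradiction)
open import Relation.Nullary.Decidable using (_×-dec_)
open import Relation.Unary using (Pred; Decidable)
open import Relation.Unary.Properties using (∁?)
open import Relation.Binary.PropositionalEquality using (refl; sym; trans; cong; cong₂; subst; _≢_; module ≡-Reasoning)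

+-exchange : ∀ a b c d → (a + b) + (c + d) ≡ (a + c) + (b + d)
+-exchange = solve-∀

fromBool : Bool → ℕ
fromBool true  = 1
fromBool false = 0

∑ : ∀ {A : Set} → List A → (A → ℕ) → ℕ
∑ []       f = 0
∑ (x ∷ xs) f = f x + ∑ xs f

syntax ∑ xs (λ x → e) = ∑[ x ∈ xs ] e

module _ {A : Set} where

  ∑-+ : ∀ (xs : List A) (f g : A → ℕ) → ∑[ x ∈ xs ] (f x + g x) ≡ ∑ xs f + ∑ xs g
  ∑-+ []       f g = refl
  ∑-+ (x ∷ xs) f g rewrite ∑-+ xs f g = +-exchange (f x) (g x) (∑ xs f) (∑ xs g)

  ∑-const : ∀ (xs : List A) c → ∑[ x ∈ xs ] c ≡ length xs * c
  ∑-const []       c = refl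
  ∑-const (x ∷ xs) c = cong (c +_) (∑-const xs c)

  ∑-cong : ∀ {f g : A → ℕ} {xs} → All (λ x → f x ≡ g x) xs → ∑ xs f ≡ ∑ xs g
  ∑-cong []         = refl
  ∑-cong (eq ∷ eqs) = cong₂ _+_ eq (∑-cong eqs)

  ∑-≤ : ∀ {f : A → ℕ} {b xs} → All (λ x → f x ≤ b) xs → ∑ xs f ≤ length xs * b
  ∑-≤ []         = z≤n
  ∑-≤ (le ∷ les) = +-mono-≤ le (∑-≤ les)

  module _ {p} {P : Pred A p} (P? : Decidable P) where

    ∑-filter-≤ : ∀ (f : A → ℕ) xs → ∑ (filter P? xs) f ≤ ∑ xs f
    ∑-filter-≤ f []       = z≤n
    ∑-filter-≤ f (x ∷ xs) with P? x
    ... | yes _ = +-monoʳ-≤ (f x) (∑-filter-≤ f xs)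
    ... | no  _ = ≤-trans (∑-filter-≤ f xs) (m≤n+m _ (f x))

    length-filter-∁ : ∀ xs → length (filter P? xs) + length (filter (∁? P?) xs) ≡ length xs
    length-filter-∁ []       = refl
    length-filter-∁ (x ∷ xs) with P? x
    ... | yes _ = cong suc (length-filter-∁ xs)
    ... | no  _ = trans (+-suc _ _) (cong suc (length-filter-∁ xs))

  length-filter-∧ : ∀ (f g : A → Bool) xs →
    length (filter (λ x → T? (f x ∧ g x)) xs) ≡ ∑[ x ∈ filter (T? ∘ g) xs ] fromBool (f x)
  length-filter-∧ f g []       = refl
  length-filter-∧ f g (x ∷ xs) with g x
  ... | false rewrite ∧-zeroʳ (f x) = length-filter-∧ f g xs
  ... | true  with f x
  ...   | true  = cong suc (length-filter-∧ f g xs)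
  ...   | false = length-filter-∧ f g xs

Disjoint : ∀ {A : Set} → List A → List A → Set
Disjoint xs ys = All (λ x → All (x ≢_) ys) xs

square≤⇒≤ : ∀ {a b} j → 2 * a + b ≡ b * b → a ≤ b * j → b ≤ suc (2 * j)
square≤⇒≤ {b = zero}  j _   _   = z≤n
square≤⇒≤ {a} {b@(suc _)} j eq a≤bj = *-cancelˡ-≤ b (begin
  b * b            ≡⟨ sym eq ⟩
  2 * a + b        ≤⟨ +-monoˡ-≤ b (*-monoʳ-≤ 2 a≤bj) ⟩
  2 * (b * j) + b  ≡⟨ identity b j ⟩
  b * suc (2 * j)  ∎)
  where
  open ≤-Reasoning
  identity : ∀ b j → 2 * (b * j) + b ≡ b * suc (2 * j)
  identity = solve-∀

[a+b]*j<a*b : ∀ {a b} j → suc (2 * j) ≤ a → suc (2 * j) ≤ b → (a + b) * j < a * b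
[a+b]*j<a*b {a} {b} j ha hb = *-cancelˡ-< 2 _ _ (begin-strict
  2 * ((a + b) * j)                  <⟨ m<m+n _ (≤-trans (≤-trans (s≤s z≤n) ha) (m≤m+n a b)) ⟩
  2 * ((a + b) * j) + (a + b)        ≡⟨ identity a b j ⟩
  a * suc (2 * j) + b * suc (2 * j)  ≤⟨ +-mono-≤ (*-monoʳ-≤ a hb) (*-monoʳ-≤ b ha) ⟩
  a * b + b * a                      ≡⟨ cong (a * b +_) (*-comm b a) ⟩
  a * b + a * b                      ≡⟨ cong (a * b +_) (sym (+-identityʳ (a * b))) ⟩
  2 * (a * b)                        ∎)
  where
  open ≤-Reasoning
  identity : ∀ a b j → 2 * ((a + b) * j) + (a + b) ≡ a * suc (2 * j) + b * suc (2 * j)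
  identity = solve-∀

≤-complement : ∀ {a b} c → 2 * c ≤ a + b → a ≤ c → c ≤ b
≤-complement {a} {b} c le a≤c = +-cancelˡ-≤ c c b (begin
  c + c  ≡⟨ cong (c +_) (sym (+-identityʳ c)) ⟩
  2 * c  ≤⟨ le ⟩
  a + b  ≤⟨ +-monoˡ-≤ b a≤c ⟩
  c + b  ∎)
  where open ≤-Reasoning

module ArcCounting {n : ℕ} (Tr : Tournament n) where

  arcs : Fin n → Fin n → ℕ
  arcs v w = fromBool (arc Tr v w)

  d⁺ d⁻ : Fin n → List (Fin n) → ℕ
  d⁺ v K = ∑[ w ∈ K ] arcs v w
  d⁻ v K = ∑[ w ∈ K ] arcs w v

  e : List (Fin n) → List (Fin n) → ℕ
  e K₁ K₂ = ∑[ v ∈ K₁ ] d⁺ v K₂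

  arcs-loop : ∀ v → arcs v v ≡ 0
  arcs-loop v rewrite loopless Tr v = refl

  arcs-pair : ∀ {v w} → v ≢ w → arcs v w + arcs w v ≡ 1
  arcs-pair {v} {w} v≢w with arc Tr v w in vw | arc Tr w v in wv
  ... | true  | true  = ⊥-elim (antisym Tr v w (vw , wv))
  ... | true  | false = refl
  ... | false | true  = refl
  ... | false | false with total Tr v w v≢w
  ...   | inj₁ vw′ = contradiction (trans (sym vw) vw′) λ ()
  ...   | inj₂ wv′ = contradiction (trans (sym wv) wv′) λ ()

  d⁺+d⁻ : ∀ {v} K → All (v ≢_) K → d⁺ v K + d⁻ v K ≡ length K
  d⁺+d⁻ {v} K v∉K = begin
    d⁺ v K + d⁻ v K                   ≡⟨ sym (∑-+ K (arcs v) (λ w → arcs w v)) ⟩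
    ∑[ w ∈ K ] (arcs v w + arcs w v)  ≡⟨ ∑-cong (All.map arcs-pair v∉K) ⟩
    ∑[ w ∈ K ] 1                      ≡⟨ ∑-const K 1 ⟩
    length K * 1                      ≡⟨ *-identityʳ _ ⟩
    length K                          ∎
    where open ≡-Reasoning

  e-∷ʳ : ∀ K₁ {w} K₂ → e K₁ (w ∷ K₂) ≡ d⁻ w K₁ + e K₁ K₂
  e-∷ʳ K₁ {w} K₂ = ∑-+ K₁ (λ v → arcs v w) (λ v → d⁺ v K₂)

  e-self-∷ : ∀ {v} K → All (v ≢_) K → e (v ∷ K) (v ∷ K) ≡ length K + e K K
  e-self-∷ {v} K v∉K = begin
    (arcs v v + d⁺ v K) + e K (v ∷ K)  ≡⟨ cong₂ _+_ (cong (_+ d⁺ v K) (arcs-loop v)) (e-∷ʳ K K) ⟩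
    d⁺ v K + (d⁻ v K + e K K)          ≡⟨ sym (+-assoc (d⁺ v K) _ _) ⟩
    (d⁺ v K + d⁻ v K) + e K K          ≡⟨ cong (_+ e K K) (d⁺+d⁻ K v∉K) ⟩
    length K + e K K                   ∎
    where open ≡-Reasoning

  e-self : ∀ K → Unique K → 2 * e K K + length K ≡ length K * length K
  e-self []      _             = refl
  e-self (v ∷ K) (v∉K ∷ uniq) = begin
    2 * e (v ∷ K) (v ∷ K) + suc l  ≡⟨ cong (λ x → 2 * x + suc l) (e-self-∷ K v∉K) ⟩
    2 * (l + e K K) + suc l        ≡⟨ regroup l (e K K) ⟩
    suc (2 * l + (2 * e K K + l))  ≡⟨ cong (λ x → suc (2 * l + x)) (e-self K uniq) ⟩
    suc (2 * l + l * l)            ≡⟨ square-suc l ⟩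
    suc l * suc l                  ∎
    where
    open ≡-Reasoning
    l = length K
    regroup : ∀ l q → 2 * (l + q) + suc l ≡ suc (2 * l + (2 * q + l))
    regroup = solve-∀
    square-suc : ∀ l → suc (2 * l + l * l) ≡ suc l * suc l
    square-suc = solve-∀

  e-between : ∀ K₁ K₂ → Disjoint K₁ K₂ → e K₁ K₂ + e K₂ K₁ ≡ length K₁ * length K₂
  e-between []       K₂ _ = trans (∑-const K₂ 0) (*-zeroʳ (length K₂))
  e-between (v ∷ K₁) K₂ (v∉K₂ ∷ disj) = begin
    (d⁺ v K₂ + e K₁ K₂) + e K₂ (v ∷ K₁)          ≡⟨ cong (d⁺ v K₂ + e K₁ K₂ +_) (e-∷ʳ K₂ K₁) ⟩
    (d⁺ v K₂ + e K₁ K₂) + (d⁻ v K₂ + e K₂ K₁)    ≡⟨ +-exchange (d⁺ v K₂) (e K₁ K₂) (d⁻ v K₂) (e K₂ K₁) ⟩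
    (d⁺ v K₂ + d⁻ v K₂) + (e K₁ K₂ + e K₂ K₁)    ≡⟨ cong₂ _+_ (d⁺+d⁻ K₂ v∉K₂) (e-between K₁ K₂ disj) ⟩
    length K₂ + length K₁ * length K₂            ∎
    where open ≡-Reasoning

  length≤ : ∀ {K} j → Unique K → All (λ v → d⁺ v K ≤ j) K → length K ≤ suc (2 * j)
  length≤ {K} j uniq bound = square≤⇒≤ j (e-self K uniq) (∑-≤ bound)

  length*length≤ : ∀ {K₁ K₂} j → Disjoint K₁ K₂ →
    All (λ v → d⁺ v K₂ ≤ j) K₁ → All (λ v → d⁺ v K₁ ≤ j) K₂ →
    length K₁ * length K₂ ≤ (length K₁ + length K₂) * j
  length*length≤ {K₁} {K₂} j disj bound₁ bound₂ = begin
    length K₁ * length K₂            ≡⟨ sym (e-between K₁ K₂ disj) ⟩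
    e K₁ K₂ + e K₂ K₁                ≤⟨ +-mono-≤ (∑-≤ bound₁) (∑-≤ bound₂) ⟩
    length K₁ * j + length K₂ * j    ≡⟨ sym (*-distribʳ-+ j (length K₁) _) ⟩
    (length K₁ + length K₂) * j      ∎
    where open ≤-Reasoning

  members : VSet n → List (Fin n)
  members X = filter (T? ∘ X) (allFin n)

  outdeg≡d⁺ : ∀ v X → outdeg Tr v X ≡ d⁺ v (members X)
  outdeg≡d⁺ v X = length-filter-∧ (arc Tr v) X (allFin n)

module _ {n : ℕ} (Tr : Tournament n) (j : ℕ) where
  open ArcCounting Tr

  low high : VSet n → List (Fin n)
  low  X = filter (λ v → outdeg Tr v X ≤? j) (members X)
  high X = filter (∁? (λ v → outdeg Tr v X ≤? j)) (members X)

  d⁺-filter-members≤ : ∀ {X v p} {P : Pred (Fin n) p} (P? : Decidable P) →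
    outdeg Tr v X ≤ j → d⁺ v (filter P? (members X)) ≤ j
  d⁺-filter-members≤ {X} {v} P? le =
    ≤-trans (∑-filter-≤ P? (arcs v) (members X)) (subst (_≤ j) (outdeg≡d⁺ v X) le)

  length-low : ∀ X → length (low X) ≤ suc (2 * j)
  length-low X = length≤ j uniq (All.map (d⁺-filter-members≤ _) (all-filter _ (members X)))
    where
    uniq : Unique (low X)
    uniq = Unique.filter⁺ _ (Unique.filter⁺ (T? ∘ X) (Unique.allFin⁺ n))

  length-high : ∀ X → 2 * suc (2 * j) ≤ size X → suc (2 * j) ≤ length (high X)
  length-high X large = ≤-complement (suc (2 * j))
    (subst (2 * suc (2 * j) ≤_) (sym (length-filter-∁ _ (members X))) large) (length-low X)

  high-into : ∀ X Y → (∀ v → j < outdeg Tr v X → ¬ j < outdeg Tr v Y) →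
    All (λ v → d⁺ v (high Y) ≤ j) (high X)
  high-into X Y excl = All.map (λ {v} ≰j → d⁺-filter-members≤ _ (≮⇒≥ (excl v (≰⇒> ≰j))))
    (all-filter _ (members X))

  high-disjoint : ∀ X Y → (∀ v → T (X v) → ¬ T (Y v)) → Disjoint (high X) (high Y)
  high-disjoint X Y disj =
    All.map (λ {v} Xv → All.map (λ Yw v≡w → disj v Xv (subst (T ∘ Y) (sym v≡w) Yw)) (in-high Y))
      (in-high X)
    where
    in-high : ∀ Z → All (T ∘ Z) (high Z)
    in-high Z = filter⁺ _ (all-filter (T? ∘ Z) (allFin n))

  outdeg-into-both : ∀ X Y → (∀ v → T (X v) → ¬ T (Y v)) →
    2 * suc (2 * j) ≤ size X → 2 * suc (2 * j) ≤ size Y →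
    Σ (Fin n) λ v → j < outdeg Tr v X × j < outdeg Tr v Y
  outdeg-into-both X Y disj largeX largeY
    with any? (λ v → (j <? outdeg Tr v X) ×-dec (j <? outdeg Tr v Y))
  ... | yes found = found
  ... | no  none  = contradiction
    (length*length≤ j (high-disjoint X Y disj) (high-into X Y excl) (high-into Y X (λ v p q → excl v q p)))
    (<⇒≱ ([a+b]*j<a*b j (length-high X largeX) (length-high Y largeY)))
    where
    excl : ∀ v → j < outdeg Tr v X → ¬ j < outdeg Tr v Y
    excl v p q = none (v , p , q)

m*4/4≡m : ∀ m → m * 4 / 4 ≡ m
m*4/4≡m m = m*n/n≡m m 4

T⇒¬T-not : ∀ b → T b → ¬ T (not b)
T⇒¬T-not true _ ()

4k+2≤4k+4 : ∀ k → 2 * suc (2 * k) ≤ suc k * 4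
4k+2≤4k+4 k = subst (2 * suc (2 * k) ≤_) (identity k) (m≤m+n (2 * suc (2 * k)) 2)
  where
  identity : ∀ k → 2 * suc (2 * k) + 2 ≡ suc k * 4
  identity = solve-∀

lemma3 : (m : ℕ) → 1 ≤ m → 4 ∣ m → (T : Tournament (2 * m)) → (S : VSet (2 * m)) →
    size S ≡ m → size (λ v → not (S v)) ≡ m →
    Σ (Fin (2 * m)) (λ v → (m / 4 ≤ outdeg T v S) × (m / 4 ≤ outdeg T v (λ w → not (S w))))
lemma3 .(zero * 4)  () (divides zero refl) T S size₀ size₁
lemma3 .(suc k * 4) _  (divides (suc k) refl) T S size₀ size₁ rewrite m*4/4≡m (suc k) =
  outdeg-into-both T k S (not ∘ S) (λ v → T⇒¬T-not (S v))
    (subst (_ ≤_) (sym size₀) (4k+2≤4k+4 k)) (subst (_ ≤_) (sym size₁) (4k+2≤4k+4 k))
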